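{- Let $n$ be a positive integer that is not a perfect square, and let $N$ be the dimension of the null space over $\mathbb{F}_2$ of $A(n+1, g(n))$. Then there are exactly $2^N$ corresponding sequences for $g(n)$.
   Context: For a non-negative integer $n$, $g(n)$ is the least integer $k$ such that there is a strictly increasing sequence of integers $n = a_1 < \cdots < a_t = k$ whose product is a perfect square; such a sequence starting at $n$ and ending at $g(n)$ is called a corresponding sequence for $g(n)$. For a positive integer $x = \prod_i p_i^{v_i}$ ($p_i$ the $i$-th prime), $\vec{v}(x)$ is the vector $(v_1 \bmod 2, \dots, v_M \bmod 2)^T$ over $\mathbb{F}_2$ with $M \geq \pi(g(n))$ ($\pi$ the prime-counting function). $A(\ell, r)$ is the matrix over $\mathbb{F}_2$ whose columns are $\vec{v}(\ell), \vec{v}(\ell+1), \dots, \vec{v}(r)$. -}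

module Defs where

open import Data.Nat using (ℕ; zero; suc; _+_; _*_; _∸_; _<_; _≤?_; _≟_)
open import Data.Nat.Divisibility using (_∣?_; quotient)
open import Data.Nat.Primality using (Prime)
open import Data.Bool using (Bool; true; false; _∧_; _xor_; not)
open import Data.Fin using (Fin; toℕ)
open import Data.List using (List; foldr; map; head; last; allFin)
open import Data.Nat.ListAction using (product)
open import Data.List.Relation.Unary.Linked using (Linked)
open import Data.Maybe using (just)
open import Data.Product using (Σ; ∃; _×_)
open import Data.Vec.Functional using (Vector)
open import Relation.Binary.PropositionalEquality using (_≡_)
open import Relation.Nullary using (¬_; yes; no)

IsSquare : ℕ → Set
IsSquare m = ∃ λ r → m ≡ r * r

SquareSeq : ℕ → ℕ → List ℕ → Set
SquareSeq n k l =
  Linked _<_ l × head l ≡ just n × last l ≡ just k × IsSquare (product l)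

IsG : ℕ → ℕ → Set
IsG n k = (∃ λ l → SquareSeq n k l)
        × (∀ k′ → k′ < k → ¬ (∃ λ l → SquareSeq n k′ l))

CorrSeq : ℕ → ℕ → Set
CorrSeq n k = Σ (List ℕ) (SquareSeq n k)

-- p-adic valuation (fuel-based; fuel x suffices for p ≥ 2)

valAux : ℕ → ℕ → ℕ → ℕ
valAux zero    p x = 0
valAux (suc f) p x with 2 ≤? p | x ≟ 0 | p ∣? x
... | yes _ | no _ | yes d = suc (valAux f p (quotient d))
... | _     | _    | _     = 0

val : ℕ → ℕ → ℕ
val p x = valAux x p x

parity : ℕ → Bool
parity zero    = false
parity (suc m) = not (parity m)

-- The p-coordinate of v(x): exponent of p in x, mod 2.
vcoord : ℕ → ℕ → Bool
vcoord p x = parity (val p x)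

sumF2 : ∀ {m} → Vector Bool m → Bool
sumF2 {m} v = foldr _xor_ false (map v (allFin m))

cols : ℕ → ℕ → ℕ
cols ℓ r = suc r ∸ ℓ

-- Row p (p prime) of A(ℓ, r); column i corresponds to x = ℓ + i.
-- Rows are indexed by the primes p themselves.
Arow : (ℓ r : ℕ) → ℕ → Vector Bool (cols ℓ r)
Arow ℓ r p i = vcoord p (ℓ + toℕ i)

InNull : (ℓ r : ℕ) → Vector Bool (cols ℓ r) → Set
InNull ℓ r c = ∀ p → Prime p → sumF2 (λ i → Arow ℓ r p i ∧ c i) ≡ false

lincomb : ∀ {N m} → Vector (Vector Bool m) N → Vector Bool N → Vector Bool m
lincomb B a i = sumF2 (λ j → a j ∧ B j i)

LinIndep : ∀ {N m} → Vector (Vector Bool m) N → Set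
LinIndep {N} {m} B =
  ∀ (a : Vector Bool N) → (∀ i → lincomb B a i ≡ false) → ∀ j → a j ≡ false

NullDim : (ℓ r N : ℕ) → Set
NullDim ℓ r N =
  Σ (Vector (Vector Bool (cols ℓ r)) N) λ B →
      (∀ j → InNull ℓ r (B j))
    × LinIndep B
    × (∀ c → InNull ℓ r c → ∃ λ a → ∀ i → c i ≡ lincomb B a i)

-- A corresponding sequence is n followed by a subset T of {n + 1, …, g(n)}.
-- With c the indicator vector of T, the product of the sequence has parity
-- vector v(n) + A(n + 1, g(n)) c, so it is a square exactly when
-- A(n + 1, g(n)) c = v(n). Conversely every solution c yields an increasing
-- sequence with square product, and its last term is g(n) by minimality of g(n).
-- The solutions form a coset of the null space (nonempty because g(n) exists),
-- so coordinates with respect to a basis identify them with F₂^N.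

module Submission where

open import Defs
open import Algebra.Bundles using (CommutativeRing)
open import Axiom.UniquenessOfIdentityProofs using (module Decidable⇒UIP)
open import Data.Bool using (Bool; true; false; _xor_; _∧_; _∨_; not; if_then_else_)
open import Data.Bool.Properties
  using ( if-cong; not-involutive; not-distribˡ-xor; xor-comm; xor-same; xor-identityʳ; ∧-comm
        ; ∧-distribˡ-xor; ∧-identityʳ; ∧-zeroʳ; xor-∧-commutativeRing )
open import Data.Empty using (⊥-elim)
open import Data.Fin using (Fin; zero; suc; toℕ; combine; funToFin; finToFun)
open import Data.Fin.Properties using (2↔Bool; finToFun-funToFin; funToFin-finToFin)
open import Data.List using (List; []; _∷_; foldr; map; tabulate; last)
open import Data.List.Properties using (map-tabulate)
open import Data.List.Relation.Unary.All as All using (All; []; _∷_)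
open import Data.List.Relation.Unary.All.Properties using (last⁺)
open import Data.List.Relation.Unary.Linked as Linked using (Linked; []; [-]; _∷_)
open import Data.List.Relation.Unary.Linked.Properties using (Linked⇒All)
open import Data.Maybe using (just)
open import Data.Maybe.Properties using (≡-dec)
open import Data.Maybe.Relation.Unary.All as Maybe using () renaming (just to just′)
open import Data.Nat
  using (ℕ; zero; suc; _+_; _*_; _^_; _≤_; _<_; _≤?_; _≟_; z<s; s≤s; >-nonZero; nonTrivial⇒n>1)
open import Data.Nat.Divisibility
open import Data.Nat.Induction using (<-rec)
open import Data.Nat.ListAction using (product)
open import Data.Nat.Primality using (Prime; prime⇒nonZero; prime⇒nonTrivial; euclidsLemma)
open import Data.Nat.Primality.Factorisation using (factorise; PrimeFactorisation)
open import Data.Nat.Properties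
open import Data.Product using (_×_; _,_; proj₁; proj₂; ∃-syntax)
open import Data.Sum using ([_,_]′)
open import Data.Vec.Functional using (Vector; tail; zipWith)
open import Function using (_∘_)
open import Function.Bundles using (Inverse; _↔_; mk↔ₛ′)
open import Relation.Binary.Definitions using (tri<; tri≈; tri>)
open import Relation.Binary.PropositionalEquality
open import Relation.Nullary using (¬_; does; yes; no)
open import Relation.Nullary.Decidable using (dec-true; dec-false)
open import Algebra.Properties.Semiring.Sum (CommutativeRing.semiring xor-∧-commutativeRing)
  using (sum; sum-cong-≗; ∑-distrib-+; ∑-comm; *-distribˡ-sum; sum-replicate-zero)

-- p-adic valuations and parity vectors

prime⇒>1 : ∀ {p} → Prime p → 1 < p
prime⇒>1 {p} pr = nonTrivial⇒n>1 p {{prime⇒nonTrivial pr}}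

prime⇒>0 : ∀ {p} → Prime p → 0 < p
prime⇒>0 pr = <-trans z<s (prime⇒>1 pr)

^-monoʳ-∣ : ∀ p {a b} → a ≤ b → p ^ a ∣ p ^ b
^-monoʳ-∣ p {zero} {b} _ = 1∣ (p ^ b)
^-monoʳ-∣ p {suc a} {suc b} (s≤s a≤b) = *-monoʳ-∣ p (^-monoʳ-∣ p a≤b)

record IsValuation (p x v : ℕ) : Set where
  constructor _,_
  field
    pᵛ∣x   : p ^ v ∣ x
    pᵛ⁺¹∤x : ¬ (p ^ suc v ∣ x)

isValuation-unique : ∀ {p x v w} → IsValuation p x v → IsValuation p x w → v ≡ w
isValuation-unique {p} {x} {v} {w} (pᵛ∣x , pᵛ⁺¹∤x) (pʷ∣x , pʷ⁺¹∤x) with <-cmp v w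
... | tri< v<w _ _ = ⊥-elim (pᵛ⁺¹∤x (∣-trans (^-monoʳ-∣ p v<w) pʷ∣x))
... | tri≈ _ v≡w _ = v≡w
... | tri> _ _ w<v = ⊥-elim (pʷ⁺¹∤x (∣-trans (^-monoʳ-∣ p w<v) pᵛ∣x))

valAux-isValuation : ∀ fuel {p x} → Prime p → 0 < x → x ≤ fuel → IsValuation p x (valAux fuel p x)
valAux-isValuation zero       _  0<x x≤0 = ⊥-elim (<⇒≱ 0<x x≤0)
valAux-isValuation (suc fuel) {p} {x} pr 0<x x≤fuel with 2 ≤? p | x ≟ 0 | p ∣? x
... | no p≱2 | _ | _ = ⊥-elim (p≱2 (prime⇒>1 pr))
... | yes _ | yes x≡0 | _ = ⊥-elim (>⇒≢ 0<x x≡0)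
... | yes _ | no _ | no p∤x = 1∣ x , λ p¹∣x → p∤x (subst (_∣ x) (*-identityʳ p) p¹∣x)
... | yes _ | no _ | yes (divides q x≡q*p) = pᵛ⁺¹∣x , pᵛ⁺²∤x
  where
  instance _ = prime⇒nonZero pr
  0<q : 0 < q
  0<q = n≢0⇒n>0 λ { refl → >⇒≢ 0<x x≡q*p }
  q<x : q < x
  q<x = subst (q <_) (sym x≡q*p) (m<m*n q p {{>-nonZero 0<q}} (prime⇒>1 pr))
  v = valAux fuel p q
  IH : IsValuation p q v
  IH = valAux-isValuation fuel pr 0<q (≤-pred (≤-trans q<x x≤fuel))
  pᵛ⁺¹∣x : p ^ suc v ∣ x
  pᵛ⁺¹∣x = subst₂ _∣_ (*-comm (p ^ v) p) (sym x≡q*p) (*-monoˡ-∣ p (IsValuation.pᵛ∣x IH))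
  pᵛ⁺²∤x : ¬ (p ^ suc (suc v) ∣ x)
  pᵛ⁺²∤x pᵛ⁺²∣x = IsValuation.pᵛ⁺¹∤x IH (*-cancelʳ-∣ p (subst₂ _∣_ (*-comm p (p ^ suc v)) x≡q*p pᵛ⁺²∣x))

val-isValuation : ∀ {p x} → Prime p → 0 < x → IsValuation p x (val p x)
val-isValuation {x = x} pr 0<x = valAux-isValuation x pr 0<x ≤-refl

val-unique : ∀ {p x v} → Prime p → 0 < x → IsValuation p x v → val p x ≡ v
val-unique pr 0<x = isValuation-unique (val-isValuation pr 0<x)

isValuation-1 : ∀ {p} → Prime p → IsValuation p 1 0
isValuation-1 {p} pr =
  ∣-refl , λ p¹∣1 → >⇒≢ (prime⇒>1 pr) (∣1⇒≡1 (subst (_∣ 1) (*-identityʳ p) p¹∣1))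

cofactor-indivisible : ∀ {p x} v → (pᵛ∣x : p ^ v ∣ x) → ¬ (p ^ suc v ∣ x) → ¬ (p ∣ quotient pᵛ∣x)
cofactor-indivisible v (divides q refl) pᵛ⁺¹∤x p∣q = pᵛ⁺¹∤x (*-monoˡ-∣ _ p∣q)

isValuation-* : ∀ {p a b v w} → Prime p →
                IsValuation p a v → IsValuation p b w → IsValuation p (a * b) (v + w)
isValuation-* {p} {a} {b} {v} {w} pr (pᵛ∣a , pᵛ⁺¹∤a) (pʷ∣b , pʷ⁺¹∤b) = pᵛ⁺ʷ∣ab , pᵛ⁺ʷ⁺¹∤ab
  where
  instance _ = prime⇒nonZero pr
  pᵛ⁺ʷ≡pᵛpʷ = ^-distribˡ-+-* p v w
  pᵛ⁺ʷ∣ab : p ^ (v + w) ∣ a * b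
  pᵛ⁺ʷ∣ab = subst (_∣ a * b) (sym pᵛ⁺ʷ≡pᵛpʷ) (*-pres-∣ pᵛ∣a pʷ∣b)
  a′ = quotient pᵛ∣a
  b′ = quotient pʷ∣b
  ab≡a′b′pᵛ⁺ʷ : a * b ≡ (a′ * b′) * p ^ (v + w)
  ab≡a′b′pᵛ⁺ʷ = begin
    a * b                          ≡⟨ cong₂ _*_ (_∣_.equality pᵛ∣a) (_∣_.equality pʷ∣b) ⟩
    (a′ * p ^ v) * (b′ * p ^ w)    ≡⟨ [m*n]*[o*p]≡[m*o]*[n*p] a′ (p ^ v) b′ (p ^ w) ⟩
    (a′ * b′) * (p ^ v * p ^ w)    ≡⟨ cong ((a′ * b′) *_) pᵛ⁺ʷ≡pᵛpʷ ⟨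
    (a′ * b′) * p ^ (v + w)        ∎
    where open ≡-Reasoning
  p∣a′b′ : p ^ suc (v + w) ∣ a * b → p ∣ a′ * b′
  p∣a′b′ pᵛ⁺ʷ⁺¹∣ab =
    *-cancelʳ-∣ (p ^ (v + w)) {{m^n≢0 p (v + w)}} (subst (p * p ^ (v + w) ∣_) ab≡a′b′pᵛ⁺ʷ pᵛ⁺ʷ⁺¹∣ab)
  pᵛ⁺ʷ⁺¹∤ab : ¬ (p ^ suc (v + w) ∣ a * b)
  pᵛ⁺ʷ⁺¹∤ab pᵛ⁺ʷ⁺¹∣ab = [ cofactor-indivisible v pᵛ∣a pᵛ⁺¹∤a , cofactor-indivisible w pʷ∣b pʷ⁺¹∤b ]′
                          (euclidsLemma a′ b′ pr (p∣a′b′ pᵛ⁺ʷ⁺¹∣ab))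

parity-+ : ∀ a b → parity (a + b) ≡ parity a xor parity b
parity-+ zero    b = refl
parity-+ (suc a) b = trans (cong not (parity-+ a b)) (not-distribˡ-xor (parity a) (parity b))

vcoord-1 : ∀ {p} → Prime p → vcoord p 1 ≡ false
vcoord-1 pr = cong parity (val-unique pr z<s (isValuation-1 pr))

vcoord-* : ∀ {p a b} → Prime p → 0 < a → 0 < b → vcoord p (a * b) ≡ vcoord p a xor vcoord p b
vcoord-* {p} {a} {b} pr 0<a 0<b = begin
  parity (val p (a * b))          ≡⟨ cong parity (val-unique pr (*-mono-< 0<a 0<b) valᵃ⁺ᵇ) ⟩
  parity (val p a + val p b)      ≡⟨ parity-+ (val p a) (val p b) ⟩
  vcoord p a xor vcoord p b       ∎
  where
  open ≡-Reasoning
  valᵃ⁺ᵇ = isValuation-* pr (val-isValuation pr 0<a) (val-isValuation pr 0<b)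

xorSum : List Bool → Bool
xorSum = foldr _xor_ false

product-pos : ∀ {l} → All (0 <_) l → 0 < product l
product-pos []           = z<s
product-pos (0<x ∷ 0<xs) = *-mono-< 0<x (product-pos 0<xs)

vcoord-product : ∀ {p l} → Prime p → All (0 <_) l → vcoord p (product l) ≡ xorSum (map (vcoord p) l)
vcoord-product pr [] = vcoord-1 pr
vcoord-product {p} {x ∷ xs} pr (0<x ∷ 0<xs) =
  trans (vcoord-* pr 0<x (product-pos 0<xs)) (cong (vcoord p x xor_) (vcoord-product pr 0<xs))

EvenExponents : ℕ → Set
EvenExponents m = ∀ p → Prime p → vcoord p m ≡ false

square⇒evenExponents : ∀ {m} → 0 < m → IsSquare m → EvenExponents m
square⇒evenExponents ()  (zero  , refl)
square⇒evenExponents _   (suc r , refl) p pr = begin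
  vcoord p (suc r * suc r)              ≡⟨ vcoord-* pr z<s z<s ⟩
  vcoord p (suc r) xor vcoord p (suc r) ≡⟨ xor-same (vcoord p (suc r)) ⟩
  false                                 ∎
  where open ≡-Reasoning

prime-divisor : ∀ {m} → 1 < m → ∃[ p ] Prime p × p ∣ m
prime-divisor {m} 1<m = go factors isFactorisation factorsPrime
  where
  open PrimeFactorisation (factorise m {{>-nonZero (<-trans z<s 1<m)}})
  go : ∀ ps → m ≡ product ps → All Prime ps → ∃[ p ] Prime p × p ∣ m
  go []       refl _          = ⊥-elim (<-irrefl refl 1<m)
  go (p ∷ ps) refl (pr ∷ _)   = p , pr , m∣m*n (product ps)

-- Dividing out p² for a prime p with p ∣ m leaves all parities unchanged, so
-- induction on m applies.
evenExponents⇒square : ∀ m → 0 < m → EvenExponents m → IsSquare m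
evenExponents⇒square = <-rec _ step
  where
  step : ∀ m → (∀ {m′} → m′ < m → 0 < m′ → EvenExponents m′ → IsSquare m′) →
         0 < m → EvenExponents m → IsSquare m
  step m IH 0<m even with m ≟ 1
  ... | yes refl = 1 , refl
  ... | no m≢1 = square-cofactor (p²∣m (val p m) (val-isValuation pr 0<m) (even p pr))
    where
    1<m = ≤∧≢⇒< 0<m (m≢1 ∘ sym)
    p  = proj₁ (prime-divisor 1<m)
    pr = proj₁ (proj₂ (prime-divisor 1<m))
    p∣m = proj₂ (proj₂ (prime-divisor 1<m))
    0<p = prime⇒>0 pr
    p²∣m : ∀ v → IsValuation p m v → parity v ≡ false → p * p ∣ m
    p²∣m zero          (_ , p∤m) _ = ⊥-elim (p∤m (subst (_∣ m) (sym (*-identityʳ p)) p∣m))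
    p²∣m (suc zero)    _          ()
    p²∣m (suc (suc v)) (pᵛ∣m , _) _ = ∣-trans (*-monoʳ-∣ p (m∣m*n (p ^ v))) pᵛ∣m
    square-cofactor : p * p ∣ m → IsSquare m
    square-cofactor (divides m′ m≡m′p²) = r * p , (begin
      m                    ≡⟨ m≡m′p² ⟩
      m′ * (p * p)         ≡⟨ cong (_* (p * p)) m′≡r² ⟩
      (r * r) * (p * p)    ≡⟨ [m*n]*[o*p]≡[m*o]*[n*p] r r p p ⟩
      (r * p) * (r * p)    ∎)
      where
      open ≡-Reasoning
      0<m′ : 0 < m′
      0<m′ = n≢0⇒n>0 λ { refl → >⇒≢ 0<m m≡m′p² }
      0<p² = *-mono-< 0<p 0<p
      m′<m : m′ < m
      m′<m = subst (m′ <_) (sym m≡m′p²)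
                   (m<m*n m′ (p * p) {{>-nonZero 0<m′}} (*-mono-< (prime⇒>1 pr) (prime⇒>1 pr)))
      even′ : EvenExponents m′
      even′ q qr = begin
        vcoord q m′                         ≡⟨ xor-identityʳ (vcoord q m′) ⟨
        vcoord q m′ xor false                ≡⟨ cong (vcoord q m′ xor_) (xor-same (vcoord q p)) ⟨
        vcoord q m′ xor (vcoord q p xor vcoord q p)
                                             ≡⟨ cong (vcoord q m′ xor_) (vcoord-* qr 0<p 0<p) ⟨
        vcoord q m′ xor vcoord q (p * p)     ≡⟨ vcoord-* qr 0<m′ 0<p² ⟨
        vcoord q (m′ * (p * p))              ≡⟨ cong (vcoord q) m≡m′p² ⟨
        vcoord q m                           ≡⟨ even q qr ⟩
        false                                ∎
      r = proj₁ (IH m′<m 0<m′ even′)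
      m′≡r² = proj₂ (IH m′<m 0<m′ even′)

-- Linear algebra over F₂

sumF2≡sum : ∀ {m} (v : Vector Bool m) → sumF2 v ≡ sum v
sumF2≡sum v = trans (cong (foldr _xor_ false) (map-tabulate (λ i → i) v)) (foldr-tabulate v)
  where
  foldr-tabulate : ∀ {m} (v : Vector Bool m) → foldr _xor_ false (tabulate v) ≡ sum v
  foldr-tabulate {zero}  v = refl
  foldr-tabulate {suc m} v = cong (v zero xor_) (foldr-tabulate (λ i → v (suc i)))

infix 8 _·_
_·_ : ∀ {m} → Vector Bool m → Vector Bool m → Bool
u · c = sum (λ i → u i ∧ c i)

·-comm : ∀ {m} (u c : Vector Bool m) → u · c ≡ c · u
·-comm u c = sum-cong-≗ (λ i → ∧-comm (u i) (c i))

·-xorʳ : ∀ {m} (u c d : Vector Bool m) → u · zipWith _xor_ c d ≡ u · c xor u · d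
·-xorʳ u c d = trans (sum-cong-≗ (λ i → ∧-distribˡ-xor (u i) (c i) (d i)))
                     (∑-distrib-+ (λ i → u i ∧ c i) (λ i → u i ∧ d i))

column : ∀ {N m} → Vector (Vector Bool m) N → Fin m → Vector Bool N
column B i j = B j i

lincomb≡· : ∀ {N m} (B : Vector (Vector Bool m) N) a i → lincomb B a i ≡ a · column B i
lincomb≡· B a i = sumF2≡sum (λ j → a j ∧ B j i)

lincomb-cong : ∀ {N m} (B : Vector (Vector Bool m) N) {a a′} → a ≗ a′ → lincomb B a ≗ lincomb B a′
lincomb-cong B {a} {a′} a≗a′ i = begin
  lincomb B a i      ≡⟨ lincomb≡· B a i ⟩
  a · column B i     ≡⟨ sum-cong-≗ (λ j → cong (_∧ B j i) (a≗a′ j)) ⟩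
  a′ · column B i    ≡⟨ lincomb≡· B a′ i ⟨
  lincomb B a′ i     ∎
  where open ≡-Reasoning

lincomb-xor : ∀ {N m} (B : Vector (Vector Bool m) N) a a′ →
              lincomb B (zipWith _xor_ a a′) ≗ zipWith _xor_ (lincomb B a) (lincomb B a′)
lincomb-xor B a a′ i = begin
  lincomb B (zipWith _xor_ a a′) i      ≡⟨ lincomb≡· B (zipWith _xor_ a a′) i ⟩
  zipWith _xor_ a a′ · column B i       ≡⟨ ·-comm (zipWith _xor_ a a′) (column B i) ⟩
  column B i · zipWith _xor_ a a′       ≡⟨ ·-xorʳ (column B i) a a′ ⟩
  column B i · a xor column B i · a′    ≡⟨ cong₂ _xor_ (·-comm (column B i) a) (·-comm (column B i) a′) ⟩
  a · column B i xor a′ · column B i    ≡⟨ cong₂ _xor_ (lincomb≡· B a i) (lincomb≡· B a′ i) ⟨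
  lincomb B a i xor lincomb B a′ i      ∎
  where open ≡-Reasoning

·-lincomb : ∀ {N m} (u : Vector Bool m) (B : Vector (Vector Bool m) N) a → u · lincomb B a ≡ a · (λ j → u · B j)
·-lincomb u B a = begin
  u · lincomb B a                               ≡⟨ sum-cong-≗ distribute ⟩
  sum (λ i → sum (λ j → u i ∧ (a j ∧ B j i)))   ≡⟨ ∑-comm (λ i j → u i ∧ (a j ∧ B j i)) ⟩
  sum (λ j → sum (λ i → u i ∧ (a j ∧ B j i)))   ≡⟨ sum-cong-≗ factor ⟩
  a · (λ j → u · B j)                           ∎
  where
  open ≡-Reasoning
  distribute : ∀ i → u i ∧ lincomb B a i ≡ sum (λ j → u i ∧ (a j ∧ B j i))
  distribute i = trans (cong (u i ∧_) (lincomb≡· B a i)) (*-distribˡ-sum (u i) (λ j → a j ∧ B j i))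
  factor : ∀ j → sum (λ i → u i ∧ (a j ∧ B j i)) ≡ a j ∧ u · B j
  factor j = trans (sum-cong-≗ (λ i → ∧-swap (u i) (a j) (B j i))) (sym (*-distribˡ-sum (a j) (λ i → u i ∧ B j i)))
    where
    ∧-swap : ∀ x y z → x ∧ (y ∧ z) ≡ y ∧ (x ∧ z)
    ∧-swap false y     z = sym (∧-zeroʳ y)
    ∧-swap true  false z = refl
    ∧-swap true  true  z = refl

rowSum≡· : ∀ ℓ r p (c : Vector Bool (cols ℓ r)) → sumF2 (λ i → Arow ℓ r p i ∧ c i) ≡ Arow ℓ r p · c
rowSum≡· ℓ r p c = sumF2≡sum (λ i → Arow ℓ r p i ∧ c i)

Solves : (ℓ r : ℕ) → (ℕ → Bool) → Vector Bool (cols ℓ r) → Set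
Solves ℓ r b c = ∀ p → Prime p → sumF2 (λ i → Arow ℓ r p i ∧ c i) ≡ b p

solves-xor : ∀ ℓ r {b b′ c d} → Solves ℓ r b c → Solves ℓ r b′ d →
             Solves ℓ r (λ p → b p xor b′ p) (zipWith _xor_ c d)
solves-xor ℓ r {b} {b′} {c} {d} Ac≡b Ad≡b′ p pr = begin
  sumF2 (λ i → Arow ℓ r p i ∧ (c i xor d i))   ≡⟨ rowSum≡· ℓ r p (zipWith _xor_ c d) ⟩
  Arow ℓ r p · zipWith _xor_ c d               ≡⟨ ·-xorʳ (Arow ℓ r p) c d ⟩
  Arow ℓ r p · c xor Arow ℓ r p · d            ≡⟨ cong₂ _xor_ (rowSum≡· ℓ r p c) (rowSum≡· ℓ r p d) ⟨
  sumF2 (λ i → Arow ℓ r p i ∧ c i) xor sumF2 (λ i → Arow ℓ r p i ∧ d i)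
                                               ≡⟨ cong₂ _xor_ (Ac≡b p pr) (Ad≡b′ p pr) ⟩
  b p xor b′ p                                 ∎
  where open ≡-Reasoning

lincomb-inNull : ∀ ℓ r {N} (B : Vector (Vector Bool (cols ℓ r)) N) → (∀ j → InNull ℓ r (B j)) →
                 ∀ a → InNull ℓ r (lincomb B a)
lincomb-inNull ℓ r {N} B B-null a p pr = begin
  sumF2 (λ i → Arow ℓ r p i ∧ lincomb B a i)   ≡⟨ rowSum≡· ℓ r p (lincomb B a) ⟩
  Arow ℓ r p · lincomb B a                     ≡⟨ ·-lincomb (Arow ℓ r p) B a ⟩
  a · (λ j → Arow ℓ r p · B j)                 ≡⟨ sum-cong-≗ vanish ⟩
  sum {N} (λ _ → false)                        ≡⟨ sum-replicate-zero N ⟩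
  false                                        ∎
  where
  open ≡-Reasoning
  vanish : ∀ j → a j ∧ Arow ℓ r p · B j ≡ false
  vanish j = trans (cong (a j ∧_) (trans (sym (rowSum≡· ℓ r p (B j))) (B-null j p pr))) (∧-zeroʳ (a j))

xor-cancelˡ : ∀ x y → x xor (x xor y) ≡ y
xor-cancelˡ false y = refl
xor-cancelˡ true  y = not-involutive y

xor≡false⇒≡ : ∀ {x y} → x xor y ≡ false → x ≡ y
xor≡false⇒≡ {false} {false} _ = refl
xor≡false⇒≡ {true}  {true}  _ = refl

module AffineSolutions (ℓ r : ℕ) {N b} (nullBasis : NullDim ℓ r N) {c₀} (c₀-solves : Solves ℓ r b c₀) where

  B : Vector (Vector Bool (cols ℓ r)) N
  B = proj₁ nullBasis

  B-null : ∀ j → InNull ℓ r (B j)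
  B-null = proj₁ (proj₂ nullBasis)

  B-independent : LinIndep B
  B-independent = proj₁ (proj₂ (proj₂ nullBasis))

  B-spans : ∀ c → InNull ℓ r c → ∃[ a ] (∀ i → c i ≡ lincomb B a i)
  B-spans = proj₂ (proj₂ (proj₂ nullBasis))

  point : Vector Bool N → Vector Bool (cols ℓ r)
  point a = zipWith _xor_ c₀ (lincomb B a)

  point-solves : ∀ a → Solves ℓ r b (point a)
  point-solves a p pr = trans (solves-xor ℓ r c₀-solves (lincomb-inNull ℓ r B B-null a) p pr)
                              (xor-identityʳ (b p))

  point-surjective : ∀ {c} → Solves ℓ r b c → ∃[ a ] c ≗ point a
  point-surjective {c} c-solves = a , λ i → begin
    c i                           ≡⟨ xor-cancelˡ (c₀ i) (c i) ⟨
    c₀ i xor (c₀ i xor c i)       ≡⟨ cong (c₀ i xor_) (xor-comm (c₀ i) (c i)) ⟩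
    c₀ i xor (c i xor c₀ i)       ≡⟨ cong (c₀ i xor_) (c-c₀≡Ba i) ⟩
    c₀ i xor lincomb B a i        ∎
    where
    open ≡-Reasoning
    c-c₀-null : InNull ℓ r (zipWith _xor_ c c₀)
    c-c₀-null p pr = trans (solves-xor ℓ r c-solves c₀-solves p pr) (xor-same (b p))
    a = proj₁ (B-spans _ c-c₀-null)
    c-c₀≡Ba = proj₂ (B-spans _ c-c₀-null)

  point-injective : ∀ {a a′} → point a ≗ point a′ → a ≗ a′
  point-injective {a} {a′} pa≗pa′ j = xor≡false⇒≡ (B-independent (zipWith _xor_ a a′) B[a-a′]≡0 j)
    where
    Ba≗Ba′ : lincomb B a ≗ lincomb B a′
    Ba≗Ba′ i = trans (sym (xor-cancelˡ (c₀ i) _)) (trans (cong (c₀ i xor_) (pa≗pa′ i)) (xor-cancelˡ (c₀ i) _))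
    B[a-a′]≡0 : ∀ i → lincomb B (zipWith _xor_ a a′) i ≡ false
    B[a-a′]≡0 i = trans (lincomb-xor B a a′ i)
                        (trans (cong (_xor lincomb B a′ i) (Ba≗Ba′ i)) (xor-same (lincomb B a′ i)))

  point-cong : ∀ {a a′} → a ≗ a′ → point a ≗ point a′
  point-cong a≗a′ i = cong (c₀ i xor_) (lincomb-cong B a≗a′ i)

-- Increasing lists in a window of ℕ and their indicator vectors

member : ℕ → List ℕ → Bool
member x []       = false
member x (y ∷ ys) = does (x ≟ y) ∨ member x ys

member-here : ∀ x ys → member x (x ∷ ys) ≡ true
member-here x ys = cong (_∨ member x ys) (dec-true (x ≟ x) refl)

member-there : ∀ {x y ys} → x ≢ y → member x (y ∷ ys) ≡ member x ys
member-there {x} {y} {ys} x≢y = cong (_∨ member x ys) (dec-false (x ≟ y) x≢y)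

member-below : ∀ {x ys} → All (x <_) ys → member x ys ≡ false
member-below                []           = refl
member-below {x} {y ∷ ys} (x<y ∷ x<ys) = trans (member-there {x} {y} {ys} (<⇒≢ x<y)) (member-below x<ys)

∷-linked : ∀ {x xs} → All (x <_) xs → Linked _<_ xs → Linked _<_ (x ∷ xs)
∷-linked []        _   = [-]
∷-linked (x<y ∷ _) xs↑ = x<y ∷ xs↑

linked-head-below : ∀ {x xs} → Linked _<_ (x ∷ xs) → All (x <_) xs
linked-head-below [-]       = []
linked-head-below (x<y ∷ l) = Linked⇒All <-trans x<y l

select : ∀ {m} → Vector Bool m → ℕ → List ℕ
select {zero}  c s = []
select {suc m} c s = if c zero then s ∷ select (tail c) (suc s) else select (tail c) (suc s)

InWindow : ℕ → ℕ → ℕ → Set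
InWindow s m x = s ≤ x × x < m + s

widen : ∀ {s m x} → InWindow (suc s) m x → InWindow s (suc m) x
widen {s} {m} {x} (s<x , x<m+1+s) = <⇒≤ s<x , subst (x <_) (+-suc m s) x<m+1+s

narrow : ∀ {s m x} → s < x → InWindow s (suc m) x → InWindow (suc s) m x
narrow {s} {m} {x} s<x (_ , x<1+m+s) = s<x , subst (x <_) (sym (+-suc m s)) x<1+m+s

select-window : ∀ {m} (c : Vector Bool m) s → All (InWindow s m) (select c s)
select-window {zero}  c s = []
select-window {suc m} c s with c zero
... | true  = (≤-refl , s≤s (m≤n+m s m)) ∷ All.map widen (select-window (tail c) (suc s))
... | false = All.map widen (select-window (tail c) (suc s))

select-linked : ∀ {m} (c : Vector Bool m) s → Linked _<_ (select c s)
select-linked {zero}  c s = []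
select-linked {suc m} c s with c zero
... | true  = ∷-linked (All.map proj₁ (select-window (tail c) (suc s))) (select-linked (tail c) (suc s))
... | false = select-linked (tail c) (suc s)

select-cong : ∀ {m} {c c′ : Vector Bool m} s → c ≗ c′ → select c s ≡ select c′ s
select-cong {zero}  s c≗c′ = refl
select-cong {suc m} s c≗c′ =
  cong₂ (λ b rest → if b then s ∷ rest else rest) (c≗c′ zero) (select-cong (suc s) (c≗c′ ∘ suc))

member-select : ∀ {m} (c : Vector Bool m) s i → member (toℕ i + s) (select c s) ≡ c i
member-select c s zero with c zero
... | true  = member-here s (select (tail c) (suc s))
... | false = member-below (All.map proj₁ (select-window (tail c) (suc s)))
member-select c s (suc i) with c zero
... | true  = trans (member-there {ys = rest} (≢-sym (<⇒≢ (s≤s (m≤n+m s (toℕ i)))))) shifted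
  where
  rest = select (tail c) (suc s)
  shifted = trans (cong (λ x → member x rest) (sym (+-suc (toℕ i) s))) (member-select (tail c) (suc s) i)
... | false = trans (cong (λ x → member x (select (tail c) (suc s))) (sym (+-suc (toℕ i) s)))
                    (member-select (tail c) (suc s) i)

select-shift : ∀ {m} s zs →
               select {m} (λ i → member (suc (toℕ i + s)) zs) (suc s) ≡ select {m} (λ i → member (toℕ i + suc s) zs) (suc s)
select-shift {m} s zs = select-cong {m} (suc s) (λ i → cong (λ x → member x zs) (sym (+-suc (toℕ i) s)))

select-member : ∀ {m} s xs → Linked _<_ xs → All (InWindow s m) xs →
                select {m} (λ i → member (toℕ i + s) xs) s ≡ xs
select-member {zero}  s []       _ _                    = refl
select-member {zero}  s (x ∷ _)  _ ((s≤x , x<s) ∷ _)    = ⊥-elim (<⇒≱ x<s s≤x)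
select-member {suc m} s []       _ _                    = select-member {m} (suc s) [] [] []
select-member {suc m} s (y ∷ ys) y∷ys↑ (y∈w ∷ ys∈w) with s ≟ y
... | yes refl = begin
  (if member s (s ∷ ys) then s ∷ rest else rest)          ≡⟨ if-cong (member-here s ys) ⟩
  s ∷ rest                                                ≡⟨ cong (s ∷_) (select-cong {m} (suc s) skip-s) ⟩
  s ∷ select {m} (λ i → member (suc (toℕ i + s)) ys) (suc s)  ≡⟨ cong (s ∷_) (select-shift {m} s ys) ⟩
  s ∷ select {m} (λ i → member (toℕ i + suc s) ys) (suc s)
    ≡⟨ cong (s ∷_) (select-member {m} (suc s) ys (Linked.tail y∷ys↑) ys∈w′) ⟩
  s ∷ ys                                                  ∎
  where
  open ≡-Reasoning
  rest = select {m} (λ i → member (suc (toℕ i + s)) (s ∷ ys)) (suc s)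
  skip-s : ∀ (i : Fin m) → member (suc (toℕ i + s)) (s ∷ ys) ≡ member (suc (toℕ i + s)) ys
  skip-s i = member-there {ys = ys} (≢-sym (<⇒≢ (s≤s (m≤n+m s (toℕ i)))))
  ys∈w′ = All.zipWith (λ (s<y , y∈w) → narrow s<y y∈w) (linked-head-below y∷ys↑ , ys∈w)
... | no s≢y = begin
  (if member s (y ∷ ys) then s ∷ rest else rest)          ≡⟨ if-cong (member-below {s} {y ∷ ys} s<y∷ys) ⟩
  rest                                                    ≡⟨ select-shift {m} s (y ∷ ys) ⟩
  select {m} (λ i → member (toℕ i + suc s) (y ∷ ys)) (suc s)  ≡⟨ select-member {m} (suc s) (y ∷ ys) y∷ys↑ y∷ys∈w′ ⟩
  y ∷ ys                                                  ∎
  where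
  open ≡-Reasoning
  rest = select {m} (λ i → member (suc (toℕ i + s)) (y ∷ ys)) (suc s)
  s<y = ≤∧≢⇒< (proj₁ y∈w) s≢y
  s<y∷ys : All (s <_) (y ∷ ys)
  s<y∷ys = s<y ∷ All.map (<-trans s<y) (linked-head-below y∷ys↑)
  y∷ys∈w′ = All.zipWith (λ (s<z , z∈w) → narrow s<z z∈w) (s<y∷ys , y∈w ∷ ys∈w)

xorSum-map-if : ∀ (f : ℕ → Bool) b x xs →
                xorSum (map f (if b then x ∷ xs else xs)) ≡ (f x ∧ b) xor xorSum (map f xs)
xorSum-map-if f true  x xs = cong (_xor xorSum (map f xs)) (sym (∧-identityʳ (f x)))
xorSum-map-if f false x xs = cong (_xor xorSum (map f xs)) (sym (∧-zeroʳ (f x)))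

xorSum-select : ∀ {m} (f : ℕ → Bool) (c : Vector Bool m) s →
                xorSum (map f (select c s)) ≡ (λ i → f (toℕ i + s)) · c
xorSum-select {zero}  f c s = refl
xorSum-select {suc m} f c s = begin
  xorSum (map f (select c s))                                ≡⟨ xorSum-map-if f (c zero) s rest ⟩
  (f s ∧ c zero) xor xorSum (map f rest)                     ≡⟨ cong ((f s ∧ c zero) xor_) (xorSum-select f (tail c) (suc s)) ⟩
  (f s ∧ c zero) xor (λ i → f (toℕ i + suc s)) · tail c      ≡⟨ cong ((f s ∧ c zero) xor_) (sum-cong-≗ shift) ⟩
  (f s ∧ c zero) xor (λ i → f (suc (toℕ i + s))) · tail c    ∎
  where
  open ≡-Reasoning
  rest = select (tail c) (suc s)
  shift : ∀ (i : Fin m) → f (toℕ i + suc s) ∧ c (suc i) ≡ f (suc (toℕ i + s)) ∧ c (suc i)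
  shift i = cong (λ x → f x ∧ c (suc i)) (+-suc (toℕ i) s)

-- Corresponding sequences

last-∷ : ∀ (x : ℕ) xs → ∃[ y ] last (x ∷ xs) ≡ just y
last-∷ x []       = x , refl
last-∷ x (y ∷ ys) = last-∷ y ys

All-last : ∀ {P : ℕ → Set} {xs y} → All P xs → last xs ≡ just y → P y
All-last {P} pxs last≡y with subst (Maybe.All P) last≡y (last⁺ pxs)
... | just′ py = py

linked-≤-last : ∀ {xs k} → Linked _<_ xs → last xs ≡ just k → All (_≤ k) xs
linked-≤-last [-]        refl = ≤-refl ∷ []
linked-≤-last (x<y ∷ ys↑) last≡k with linked-≤-last ys↑ last≡k
... | y≤k ∷ ys≤k = ≤-trans (<⇒≤ x<y) y≤k ∷ y≤k ∷ ys≤k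

square-root-unique : ∀ {r s} → r * r ≡ s * s → r ≡ s
square-root-unique {r} {s} r²≡s² with <-cmp r s
... | tri< r<s _ _ = ⊥-elim (<⇒≢ (*-mono-< r<s r<s) r²≡s²)
... | tri≈ _ r≡s _ = r≡s
... | tri> _ _ s<r = ⊥-elim (<⇒≢ (*-mono-< s<r s<r) (sym r²≡s²))

isSquare-irrelevant : ∀ {m} (sq sq′ : IsSquare m) → sq ≡ sq′
isSquare-irrelevant (r , m≡r²) (s , m≡s²) with square-root-unique {r} {s} (trans (sym m≡r²) m≡s²)
... | refl = cong (r ,_) (≡-irrelevant m≡r² m≡s²)

squareSeq-irrelevant : ∀ {n k l} (σ σ′ : SquareSeq n k l) → σ ≡ σ′
squareSeq-irrelevant (l↑ , hd , lt , sq) (l↑′ , hd′ , lt′ , sq′) =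
  cong₂ _,_ (Linked.irrelevant <-irrelevant l↑ l↑′)
    (cong₂ _,_ (maybe-irr hd hd′) (cong₂ _,_ (maybe-irr lt lt′) (isSquare-irrelevant sq sq′)))
  where open Decidable⇒UIP (≡-dec _≟_) renaming (≡-irrelevant to maybe-irr)

corrSeq-≡ : ∀ {n k} {σ τ : CorrSeq n k} → proj₁ σ ≡ proj₁ τ → σ ≡ τ
corrSeq-≡ {σ = l , σ} {.l , τ} refl = cong (l ,_) (squareSeq-irrelevant σ τ)

-- Binary expansions

fromBits : ∀ {N} → Vector Bool N → Fin (2 ^ N)
fromBits a = funToFin (Inverse.from 2↔Bool ∘ a)

toBits : ∀ {N} → Fin (2 ^ N) → Vector Bool N
toBits x = Inverse.to 2↔Bool ∘ finToFun x

funToFin-cong : ∀ {m n} {f g : Fin m → Fin n} → f ≗ g → funToFin f ≡ funToFin g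
funToFin-cong {zero}  f≗g = refl
funToFin-cong {suc m} f≗g = cong₂ combine (f≗g zero) (funToFin-cong (f≗g ∘ suc))

fromBits-cong : ∀ {N} {a a′ : Vector Bool N} → a ≗ a′ → fromBits a ≡ fromBits a′
fromBits-cong a≗a′ = funToFin-cong (cong (Inverse.from 2↔Bool) ∘ a≗a′)

toBits-fromBits : ∀ {N} (a : Vector Bool N) → toBits (fromBits a) ≗ a
toBits-fromBits a i = trans (cong (Inverse.to 2↔Bool) (finToFun-funToFin (Inverse.from 2↔Bool ∘ a) i))
                            (Inverse.strictlyInverseˡ 2↔Bool (a i))

fromBits-toBits : ∀ {N} (x : Fin (2 ^ N)) → fromBits (toBits {N} x) ≡ x
fromBits-toBits {N} x =
  trans (funToFin-cong {N} (Inverse.strictlyInverseʳ 2↔Bool ∘ finToFun x)) (funToFin-finToFin {N} x)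

-- Sequences n < a₂ < ⋯ < aₜ ≤ r, encoded by the indicator vector of {a₂, …, aₜ}
-- as a subset of the columns n + 1, …, r of A(n + 1, r).
module Window (n r : ℕ) (0<n : 0 < n) (n≤r : n ≤ r) where

  m : ℕ
  m = cols (suc n) r

  toSeq : Vector Bool m → List ℕ
  toSeq c = n ∷ select c (suc n)

  indicator : List ℕ → Vector Bool m
  indicator l i = member (toℕ i + suc n) l

  window-end : m + suc n ≡ suc r
  window-end = trans (+-suc m n) (cong suc (m∸n+n≡m n≤r))

  window-≤ : ∀ {x} → InWindow (suc n) m x → x ≤ r
  window-≤ {x} (_ , x<end) = ≤-pred (subst (x <_) window-end x<end)

  indicator-∷ : ∀ xs → indicator (n ∷ xs) ≗ λ i → member (toℕ i + suc n) xs
  indicator-∷ xs i = member-there {ys = xs} (≢-sym (<⇒≢ (<-≤-trans (n<1+n n) (m≤n+m (suc n) (toℕ i)))))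

  toSeq-linked : ∀ c → Linked _<_ (toSeq c)
  toSeq-linked c = ∷-linked (All.map proj₁ (select-window c (suc n))) (select-linked c (suc n))

  toSeq-≤ : ∀ c → All (_≤ r) (toSeq c)
  toSeq-≤ c = n≤r ∷ All.map window-≤ (select-window c (suc n))

  toSeq-pos : ∀ c → All (0 <_) (toSeq c)
  toSeq-pos c = 0<n ∷ All.map (λ (n<x , _) → <-trans 0<n n<x) (select-window c (suc n))

  indicator-toSeq : ∀ c → indicator (toSeq c) ≗ c
  indicator-toSeq c i = trans (indicator-∷ (select c (suc n)) i) (member-select c (suc n) i)

  toSeq-indicator-∷ : ∀ {xs} → Linked _<_ (n ∷ xs) → All (_≤ r) xs → toSeq (indicator (n ∷ xs)) ≡ n ∷ xs
  toSeq-indicator-∷ {xs} n∷xs↑ xs≤r =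
    cong (n ∷_) (trans (select-cong (suc n) (indicator-∷ xs)) (select-member (suc n) xs (Linked.tail n∷xs↑) xs∈w))
    where
    xs∈w = All.zipWith (λ {x} (n<x , x≤r) → n<x , subst (x <_) (sym window-end) (s≤s x≤r))
                       (linked-head-below n∷xs↑ , xs≤r)

  vcoord-toSeq : ∀ {p} → Prime p → ∀ c →
                 vcoord p (product (toSeq c)) ≡ vcoord p n xor sumF2 (λ i → Arow (suc n) r p i ∧ c i)
  vcoord-toSeq {p} pr c = begin
    vcoord p (product (toSeq c))                                ≡⟨ vcoord-product pr (toSeq-pos c) ⟩
    vcoord p n xor xorSum (map (vcoord p) (select c (suc n)))   ≡⟨ cong (vcoord p n xor_) (xorSum-select (vcoord p) c (suc n)) ⟩
    vcoord p n xor (λ i → vcoord p (toℕ i + suc n)) · c         ≡⟨ cong (vcoord p n xor_) (sum-cong-≗ reorder) ⟩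
    vcoord p n xor Arow (suc n) r p · c                         ≡⟨ cong (vcoord p n xor_) (rowSum≡· (suc n) r p c) ⟨
    vcoord p n xor sumF2 (λ i → Arow (suc n) r p i ∧ c i)       ∎
    where
    open ≡-Reasoning
    reorder : ∀ i → vcoord p (toℕ i + suc n) ∧ c i ≡ Arow (suc n) r p i ∧ c i
    reorder i = cong (λ x → vcoord p x ∧ c i) (+-comm (toℕ i) (suc n))

  v[n] : ℕ → Bool
  v[n] p = vcoord p n

  square⇒solves : ∀ c → IsSquare (product (toSeq c)) → Solves (suc n) r v[n] c
  square⇒solves c sq p pr =
    sym (xor≡false⇒≡ (trans (sym (vcoord-toSeq pr c)) even))
    where even = square⇒evenExponents (product-pos (toSeq-pos c)) sq p pr

  solves⇒square : ∀ c → Solves (suc n) r v[n] c → IsSquare (product (toSeq c))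
  solves⇒square c Ac≡v[n] = evenExponents⇒square _ (product-pos (toSeq-pos c))
    λ p pr → trans (vcoord-toSeq pr c) (trans (cong (vcoord p n xor_) (Ac≡v[n] p pr)) (xor-same (vcoord p n)))

squareSeq⇒≤ : ∀ {n k l} → SquareSeq n k l → n ≤ k
squareSeq⇒≤ {l = _ ∷ _} (l↑ , refl , last≡k , _) = All.head (linked-≤-last l↑ last≡k)

module Count (n : ℕ) (0<n : 0 < n) (k : ℕ) (k≡g[n] : IsG n k) (N : ℕ) (nullBasis : NullDim (suc n) k N)
  where

  open Window n k 0<n (squareSeq⇒≤ (proj₂ (proj₁ k≡g[n])))

  toSeq-indicator : ∀ {l} → SquareSeq n k l → toSeq (indicator l) ≡ l
  toSeq-indicator {_ ∷ xs} (l↑ , refl , last≡k , _) = toSeq-indicator-∷ l↑ (All.tail (linked-≤-last l↑ last≡k))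

  squareSeq-solves : ∀ {l} → SquareSeq n k l → Solves (suc n) k v[n] (indicator l)
  squareSeq-solves {l} σ@(_ , _ , _ , sq) =
    square⇒solves (indicator l) (subst (IsSquare ∘ product) (sym (toSeq-indicator σ)) sq)

  -- Minimality of g(n) forces the sequence to end exactly at k.
  solves-squareSeq : ∀ {c} → Solves (suc n) k v[n] c → SquareSeq n k (toSeq c)
  solves-squareSeq {c} Ac≡v[n] = toSeq-linked c , refl , last≡k , sq
    where
    sq = solves⇒square c Ac≡v[n]
    y = proj₁ (last-∷ n (select c (suc n)))
    last≡y = proj₂ (last-∷ n (select c (suc n)))
    y≡k : y ≡ k
    y≡k = ≤-antisym (All-last (toSeq-≤ c) last≡y)
                    (≮⇒≥ λ y<k → proj₂ k≡g[n] y y<k (toSeq c , toSeq-linked c , refl , last≡y , sq))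
    last≡k = trans last≡y (cong just y≡k)

  open AffineSolutions (suc n) k nullBasis (squareSeq-solves (proj₂ (proj₁ k≡g[n])))

  coordinates : ∀ {l} → SquareSeq n k l → Vector Bool N
  coordinates σ = proj₁ (point-surjective (squareSeq-solves σ))

  indicator≗point : ∀ {l} (σ : SquareSeq n k l) → indicator l ≗ point (coordinates σ)
  indicator≗point σ = proj₂ (point-surjective (squareSeq-solves σ))

  to : Fin (2 ^ N) → CorrSeq n k
  to x = toSeq (point (toBits x)) , solves-squareSeq (point-solves (toBits x))

  from : CorrSeq n k → Fin (2 ^ N)
  from (_ , σ) = fromBits (coordinates σ)

  to-from : ∀ τ → to (from τ) ≡ τ
  to-from (l , σ) = corrSeq-≡ (trans (cong (n ∷_) (select-cong {m} (suc n) point≗indicator)) (toSeq-indicator σ))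
    where
    point≗indicator : point (toBits (fromBits (coordinates σ))) ≗ indicator l
    point≗indicator i = trans (point-cong (toBits-fromBits (coordinates σ)) i) (sym (indicator≗point σ i))

  from-to : ∀ x → from (to x) ≡ x
  from-to x = trans (fromBits-cong (sym ∘ point-injective point≗point)) (fromBits-toBits {N} x)
    where
    point≗point : point (toBits x) ≗ point (coordinates (proj₂ (to x)))
    point≗point i = trans (sym (indicator-toSeq (point (toBits x)) i)) (indicator≗point (proj₂ (to x)) i)

  count : Fin (2 ^ N) ↔ CorrSeq n k
  count = mk↔ₛ′ to from to-from from-to

corollary2p9 : (n : ℕ) → 1 ≤ n → ¬ IsSquare n →
                 (k : ℕ) → IsG n k →
                 (N : ℕ) → NullDim (suc n) k N →
                 Fin (2 ^ N) ↔ CorrSeq n k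
corollary2p9 n 0<n _ k k≡g[n] N nullBasis = Count.count n 0<n k k≡g[n] N nullBasis
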